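{- Let $t\equiv 2\pmod 4$ and let $\beta\in A_t$ be a product of two disjoint cycles of even lengths $k_1,k_2$; set $k=k_1+k_2$. Let $\alpha\in A_t$ be a product of $r$ disjoint transpositions, where $r$ is whichever of $k/2$ and $k/2-1$ is even. Then there exist $\gamma_1,\gamma_2\in A_t$ such that $\gamma_2^{ -1}\,[\alpha,\gamma_1]\,\gamma_2=\beta$.
   Context: $A_t$ is the alternating group on $\{1,\ldots,t\}$. The commutator is $[\alpha,\gamma]=\alpha\gamma\alpha^{ -1}\gamma^{ -1}$. -}

module Defs where

open import Data.Nat using (ℕ; zero; suc; _≤_)
open import Data.Nat.DivMod using (_%_; m%n<n)
open import Data.Nat.Divisibility using (_∣_)
open import Data.Fin using (Fin; toℕ; fromℕ<)
open import Data.Fin.Permutation using (Permutation′; _⟨$⟩ʳ_; _⟨$⟩ˡ_; transpose)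
open import Data.List using (List; length; foldr)
open import Data.List.Relation.Unary.All using (All)
open import Data.Product using (Σ; _×_; _,_; ∃)
open import Function using (id; _∘_)
open import Function.Definitions using (Injective)
open import Relation.Binary.PropositionalEquality using (_≡_; _≢_)

-- product of a list of transpositions (composition of functions, rightmost applied first)
prodTransp : ∀ {t} → List (Fin t × Fin t) → Fin t → Fin t
prodTransp = foldr (λ { (i , j) f → (transpose i j ⟨$⟩ʳ_) ∘ f }) id

-- π ∈ A_t : π is a product of an even number of transpositions
IsEven : ∀ {t} → Permutation′ t → Set
IsEven {t} π = Σ (List (Fin t × Fin t)) λ ls →
  All (λ { (i , j) → i ≢ j }) ls × (2 ∣ length ls) ×
  (∀ x → π ⟨$⟩ʳ x ≡ prodTransp ls x)

cyc : ∀ {k} → Fin k → Fin k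
cyc {suc k} i = fromℕ< (m%n<n (suc (toℕ i)) (suc k))

IsTwoDisjointCycles : ∀ {t} → Permutation′ t → ℕ → ℕ → Set
IsTwoDisjointCycles {t} β k₁ k₂ =
  Σ (Fin k₁ → Fin t) λ a → Σ (Fin k₂ → Fin t) λ b →
    Injective _≡_ _≡_ a × Injective _≡_ _≡_ b × (∀ i j → a i ≢ b j) ×
    (∀ i → β ⟨$⟩ʳ a i ≡ a (cyc i)) × (∀ j → β ⟨$⟩ʳ b j ≡ b (cyc j)) ×
    (∀ x → (∀ i → x ≢ a i) → (∀ j → x ≢ b j) → β ⟨$⟩ʳ x ≡ x)

IsDisjointTranspositions : ∀ {t} → Permutation′ t → ℕ → Set
IsDisjointTranspositions {t} α r =
  Σ (Fin r → Fin t) λ x → Σ (Fin r → Fin t) λ y →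
    Injective _≡_ _≡_ x × Injective _≡_ _≡_ y × (∀ i j → x i ≢ y j) ×
    (∀ i → α ⟨$⟩ʳ x i ≡ y i) × (∀ i → α ⟨$⟩ʳ y i ≡ x i) ×
    (∀ z → (∀ i → z ≢ x i) → (∀ i → z ≢ y i) → α ⟨$⟩ʳ z ≡ z)

-- commutator [α,γ] = α γ α⁻¹ γ⁻¹ as a function (rightmost applied first)
comm : ∀ {t} → Permutation′ t → Permutation′ t → Fin t → Fin t
comm α γ z = α ⟨$⟩ʳ (γ ⟨$⟩ʳ (α ⟨$⟩ˡ (γ ⟨$⟩ˡ z)))

module Submission where

-- Lemma 2.6.  Write β = (a₀ … a_{2P+1}) (b₀ … b_{2Q+1}), so k = 2P + 2Q + 4, and let α
-- swap r pairs, r ∈ {P+Q+1, P+Q+2}.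
-- Idea: β = S ∘ T for two involutions.  Reading each cycle as a path indexed by ℕ, T and S
-- act as the reflections n ↦ c - n and n ↦ (c + 1) - n, and two consecutive reflections
-- compose to the rotation n ↦ n + 1.  Concretely T swaps a_n ↔ a_{2P-n}, b_n ↔ b_{2Q+1-n}
-- (fixing a_P, a_{2P+1}) and S swaps a_n ↔ a_{2P+1-n}, b_{n+1} ↔ b_{2Q+1-n} (fixing b₀,
-- b_{Q+1}); each has P+Q+1 two-cycles.

open import Defs
open import Data.Nat using (ℕ; zero; suc; _+_; _*_; _∸_; _≤_; _<_; _≤?_; _<?_; z≤n; s≤s; s≤s⁻¹)
open import Data.Nat.Properties
  using ( ≤-refl; ≤-reflexive; ≤-trans; ≤-antisym; <-trans; <-≤-trans; <⇒≤; <⇒≢; <⇒≱; ≰⇒>; ≮⇒≥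
        ; ≤∧≢⇒<; n≤1+n; n<1+n; 1+n≰n; 0≢1+n; m≤m+n; +-suc; +-identityʳ; +-monoʳ-≤; +-cancelˡ-≤
        ; +-cancelˡ-≡; *-comm; *-assoc; *-distribʳ-+; m∸n≤m; n∸n≡0; m+n∸n≡m; m∸n+n≡m; m∸[m∸n]≡n
        ; +-∸-assoc; ∸-cancelˡ-≡; m+n≤o⇒m≤o∸n; m≤o∸n⇒m+n≤o; module ≤-Reasoning)
  renaming (suc-injective to ℕ-suc-injective)
open import Data.Nat.DivMod using (_%_; _/_; _mod_; m<n⇒m%n≡m; n%n≡0; m*n%n≡0; [m+kn]%n≡m%n; m*n/n≡m)
open import Data.Nat.Divisibility using (_∣_; divides; ∣m∣n⇒∣m+n)
open import Data.Fin using (Fin; zero; suc; toℕ; fromℕ<; splitAt; join; _↑ˡ_; _↑ʳ_)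
open import Data.Fin.Properties
  using ( _≟_; any?; all?; ¬∀⟶∃¬; injective⇒≤; suc-injective; join-splitAt
        ; toℕ-fromℕ<; toℕ-injective; toℕ<n)
open import Data.Fin.Permutation
  using (Permutation′; _⟨$⟩ʳ_; _⟨$⟩ˡ_; transpose; _∘ₚ_; flip; inverseˡ; inverseʳ)
import Data.Fin.Permutation as Perm
open import Data.List using (List; []; _∷_; length) renaming (_++_ to _++ᴸ_)
open import Data.List.Properties using (length-++)
open import Data.List.Relation.Unary.All using (All; []; _∷_)
open import Data.List.Relation.Unary.All.Properties using (++⁺)
open import Data.Vec.Functional using (_++_) renaming (_∷_ to _◂_)
open import Data.Vec.Functional.Properties using (lookup-++ˡ; lookup-++ʳ)
open import Data.Product using (Σ; ∃; _×_; _,_; proj₁; proj₂)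
open import Data.Sum using (_⊎_; inj₁; inj₂; [_,_]) renaming (map to ⊎-map)
open import Data.Unit using (⊤; tt)
open import Data.Empty using (⊥-elim)
open import Function using (_∘_)
open import Function.Definitions using (Injective)
open import Relation.Nullary using (Dec; yes; no)
open import Relation.Nullary.Decidable using (dec-true; dec-false)
open import Relation.Binary.PropositionalEquality hiding ([_])

private variable
  t r m n c : ℕ

transpose-left : (i j : Fin t) → transpose i j ⟨$⟩ʳ i ≡ j
transpose-left i j rewrite dec-true (i ≟ i) refl = refl

transpose-right : (i j : Fin t) → transpose i j ⟨$⟩ʳ j ≡ i
transpose-right i j with i ≟ j
... | yes refl = transpose-left i i
... | no i≢j rewrite dec-false (j ≟ i) (i≢j ∘ sym) | dec-true (j ≟ j) refl = refl

transpose-other : (i j k : Fin t) → k ≢ i → k ≢ j → transpose i j ⟨$⟩ʳ k ≡ k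
transpose-other i j k k≢i k≢j rewrite dec-false (k ≟ i) k≢i | dec-false (k ≟ j) k≢j = refl

Word : ℕ → Set
Word t = List (Fin t × Fin t)

Genuine : Fin t × Fin t → Set
Genuine (i , j) = i ≢ j

permOf : Word t → Permutation′ t
permOf [] = Perm.id
permOf ((i , j) ∷ w) = permOf w ∘ₚ transpose i j

permOf-action : (w : Word t) (x : Fin t) → permOf w ⟨$⟩ʳ x ≡ prodTransp w x
permOf-action [] x = refl
permOf-action ((i , j) ∷ w) x = cong (transpose i j ⟨$⟩ʳ_) (permOf-action w x)

prodTransp-++ : (v w : Word t) (x : Fin t) → prodTransp (v ++ᴸ w) x ≡ prodTransp v (prodTransp w x)
prodTransp-++ [] w x = refl
prodTransp-++ ((i , j) ∷ v) w x = cong (transpose i j ⟨$⟩ʳ_) (prodTransp-++ v w x)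

prodTransp-injective : (w : Word t) → Injective _≡_ _≡_ (prodTransp w)
prodTransp-injective w {x} {y} eq = begin
  x                                  ≡⟨ inverseˡ (permOf w) ⟨
  permOf w ⟨$⟩ˡ (permOf w ⟨$⟩ʳ x)    ≡⟨ cong (permOf w ⟨$⟩ˡ_) same-image ⟩
  permOf w ⟨$⟩ˡ (permOf w ⟨$⟩ʳ y)    ≡⟨ inverseˡ (permOf w) ⟩
  y                                  ∎
  where
  open ≡-Reasoning
  same-image : permOf w ⟨$⟩ʳ x ≡ permOf w ⟨$⟩ʳ y
  same-image = trans (permOf-action w x) (trans eq (sym (permOf-action w y)))

EvenWord : Word t → Set
EvenWord w = All Genuine w × 2 ∣ length w

permOf-even : (w : Word t) → EvenWord w → IsEven (permOf w)
permOf-even w (genuine , even) = w , genuine , even , permOf-action w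

even-∘ₚ : {π ρ : Permutation′ t} → IsEven π → IsEven ρ → IsEven (π ∘ₚ ρ)
even-∘ₚ {π = π} {ρ} (u , gu , eu , πu) (v , gv , ev , ρv) =
  v ++ᴸ u , ++⁺ gv gu , subst (2 ∣_) (sym (length-++ v)) (∣m∣n⇒∣m+n ev eu) ,
  λ x → trans (trans (ρv (π ⟨$⟩ʳ x)) (cong (prodTransp v) (πu x))) (sym (prodTransp-++ v u x))

parity : (n : ℕ) → 2 ∣ n ⊎ 2 ∣ suc n
parity zero = inj₁ (divides 0 refl)
parity (suc n) with parity n
... | inj₁ (divides q n≡q*2) = inj₂ (divides (suc q) (cong (λ k → suc (suc k)) n≡q*2))
... | inj₂ 2∣1+n = inj₁ 2∣1+n

-- Any injection Fin n → Fin t is carried onto any other by a product of genuine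
-- transpositions: place the images one at a time, by induction on n.
transpositionsBetween : (f g : Fin n → Fin t) → Injective _≡_ _≡_ f → Injective _≡_ _≡_ g →
  Σ (Word t) λ w → All Genuine w × (∀ i → prodTransp w (f i) ≡ g i)
transpositionsBetween {zero} f g f-inj g-inj = [] , [] , λ ()
transpositionsBetween {suc n} f g f-inj g-inj
  with transpositionsBetween (f ∘ suc) (g ∘ suc) (suc-injective ∘ f-inj) (suc-injective ∘ g-inj)
... | w , genuine , moves with prodTransp w (f zero) ≟ g zero
...   | yes moves₀ = w , genuine , λ { zero → moves₀ ; (suc i) → moves i }
...   | no x≢g₀ = (x , g zero) ∷ w , x≢g₀ ∷ genuine , λ
        { zero → transpose-left x (g zero)
        ; (suc i) → trans (cong (transpose x (g zero) ⟨$⟩ʳ_) (moves i))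
                          (transpose-other x (g zero) (g (suc i)) (away i) (zero≢suc ∘ g-inj ∘ sym)) }
  where
  x = prodTransp w (f zero)
  zero≢suc : {i : Fin n} → zero ≢ suc i
  zero≢suc ()
  away : (i : Fin n) → g (suc i) ≢ x
  away i eq = zero≢suc (f-inj (prodTransp-injective w (trans (sym eq) (sym (moves i)))))

++-all : {X : Set} {P : X → Set} (f : Fin m → X) (g : Fin n → X) →
  (∀ i → P (f i)) → (∀ j → P (g j)) → ∀ k → P ((f ++ g) k)
++-all {m = m} f g Pf Pg k with splitAt m k
... | inj₁ i = Pf i
... | inj₂ j = Pg j

++-injective : {X : Set} (f : Fin m → X) (g : Fin n → X) → Injective _≡_ _≡_ f → Injective _≡_ _≡_ g →
  (∀ i j → f i ≢ g j) → Injective _≡_ _≡_ (f ++ g)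
++-injective {m = m} {n = n} f g f-inj g-inj f≢g {k} {l} eq =
  trans (sym (join-splitAt m n k)) (trans (halves (splitAt m k) (splitAt m l) eq) (join-splitAt m n l))
  where
  halves : ∀ x y → [ f , g ] x ≡ [ f , g ] y → join m n x ≡ join m n y
  halves (inj₁ i) (inj₁ j) e = cong (_↑ˡ n) (f-inj e)
  halves (inj₁ i) (inj₂ j) e = ⊥-elim (f≢g i j e)
  halves (inj₂ i) (inj₁ j) e = ⊥-elim (f≢g j i (sym e))
  halves (inj₂ i) (inj₂ j) e = cong (m ↑ʳ_) (g-inj e)

-- A pair system: r disjoint two-element sets {fst s, snd s} in Fin t, i.e. the two-cycles of
-- an involution with r two-cycles.
record Pairs (t r : ℕ) : Set where
  field
    fst snd       : Fin r → Fin t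
    fst-injective : Injective _≡_ _≡_ fst
    snd-injective : Injective _≡_ _≡_ snd
    fst≢snd       : ∀ s s′ → fst s ≢ snd s′

open Pairs

_∉_ : Fin t → Pairs t r → Set
z ∉ p = (∀ s → z ≢ fst p s) × (∀ s → z ≢ snd p s)

SwapsPairs : (Fin t → Fin t) → Pairs t r → Set
SwapsPairs F p = ∀ s → F (fst p s) ≡ snd p s × F (snd p s) ≡ fst p s

record Swaps (F : Fin t → Fin t) (p : Pairs t r) : Set where
  field
    swaps : SwapsPairs F p
    fixes : ∀ z → z ∉ p → F z ≡ z

open Swaps

transpositionPairs : (α : Permutation′ t) → IsDisjointTranspositions α r → Σ (Pairs t r) (Swaps (α ⟨$⟩ʳ_))
transpositionPairs α (x , y , x-inj , y-inj , x≢y , αx , αy , α-fixes) =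
  record { fst = x ; snd = y ; fst-injective = x-inj ; snd-injective = y-inj ; fst≢snd = x≢y } ,
  record { swaps = λ s → αx s , αy s ; fixes = λ z (z∉x , z∉y) → α-fixes z z∉x z∉y }

swaps-inverse : (π : Permutation′ t) (p : Pairs t r) → Swaps (π ⟨$⟩ʳ_) p → Swaps (π ⟨$⟩ˡ_) p
swaps-inverse π p π-swaps = record
  { swaps = λ s → back (proj₂ (swaps π-swaps s)) , back (proj₁ (swaps π-swaps s))
  ; fixes = λ z z∉p → back (fixes π-swaps z z∉p) }
  where
  back : ∀ {x y} → π ⟨$⟩ʳ x ≡ y → π ⟨$⟩ˡ y ≡ x
  back refl = inverseˡ π

MapsPairs : Permutation′ t → Pairs t r → Pairs t r → Set
MapsPairs π p q = ∀ s →
    (π ⟨$⟩ʳ fst p s ≡ fst q s × π ⟨$⟩ʳ snd p s ≡ snd q s)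
  ⊎ (π ⟨$⟩ʳ fst p s ≡ snd q s × π ⟨$⟩ʳ snd p s ≡ fst q s)

mapsPairs-flip : (π : Permutation′ t) (p q : Pairs t r) → MapsPairs π p q → MapsPairs (flip π) q p
mapsPairs-flip π p q maps s =
  ⊎-map (λ (fst↦fst , snd↦snd) → back fst↦fst , back snd↦snd)
        (λ (fst↦snd , snd↦fst) → back snd↦fst , back fst↦snd) (maps s)
  where
  back : ∀ {x y} → π ⟨$⟩ʳ x ≡ y → π ⟨$⟩ˡ y ≡ x
  back refl = inverseˡ π

conjugate-swaps : {F : Fin t → Fin t} (ρ : Permutation′ t) (p q : Pairs t r) →
  Swaps F p → MapsPairs ρ p q → Swaps (λ z → ρ ⟨$⟩ʳ F (ρ ⟨$⟩ˡ z)) q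
conjugate-swaps {F = F} ρ p q F-swaps maps = record { swaps = λ s → swapped s (maps s) ; fixes = fixed }
  where
  back : ∀ {x y} → ρ ⟨$⟩ʳ x ≡ y → ρ ⟨$⟩ˡ y ≡ x
  back refl = inverseˡ ρ
  through : ∀ {x y x′ y′} → ρ ⟨$⟩ʳ x ≡ y → F x ≡ x′ → ρ ⟨$⟩ʳ x′ ≡ y′ →
    ρ ⟨$⟩ʳ F (ρ ⟨$⟩ˡ y) ≡ y′
  through ρx Fx ρx′ = trans (cong (λ w → ρ ⟨$⟩ʳ F w) (back ρx)) (trans (cong (ρ ⟨$⟩ʳ_) Fx) ρx′)
  swapped : ∀ s → _ → _
  swapped s (inj₁ (ρfst , ρsnd)) =
    through ρfst (proj₁ (swaps F-swaps s)) ρsnd , through ρsnd (proj₂ (swaps F-swaps s)) ρfst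
  swapped s (inj₂ (ρfst , ρsnd)) =
    through ρsnd (proj₂ (swaps F-swaps s)) ρfst , through ρfst (proj₁ (swaps F-swaps s)) ρsnd
  fixed : ∀ z → z ∉ q → ρ ⟨$⟩ʳ F (ρ ⟨$⟩ˡ z) ≡ z
  fixed z (z∉fst , z∉snd) = trans (cong (ρ ⟨$⟩ʳ_) (fixes F-swaps _ (outside-fst , outside-snd))) (inverseʳ ρ)
    where
    outside-fst : ∀ s → ρ ⟨$⟩ˡ z ≢ fst p s
    outside-fst s eq with maps s
    ... | inj₁ (ρfst , _) = z∉fst s (trans (sym (inverseʳ ρ)) (trans (cong (ρ ⟨$⟩ʳ_) eq) ρfst))
    ... | inj₂ (ρfst , _) = z∉snd s (trans (sym (inverseʳ ρ)) (trans (cong (ρ ⟨$⟩ʳ_) eq) ρfst))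
    outside-snd : ∀ s → ρ ⟨$⟩ˡ z ≢ snd p s
    outside-snd s eq with maps s
    ... | inj₁ (_ , ρsnd) = z∉snd s (trans (sym (inverseʳ ρ)) (trans (cong (ρ ⟨$⟩ʳ_) eq) ρsnd))
    ... | inj₂ (_ , ρsnd) = z∉fst s (trans (sym (inverseʳ ρ)) (trans (cong (ρ ⟨$⟩ʳ_) eq) ρsnd))

points : Pairs t r → Fin (r + r) → Fin t
points p = fst p ++ snd p

points-injective : (p : Pairs t r) → Injective _≡_ _≡_ (points p)
points-injective p = ++-injective (fst p) (snd p) (fst-injective p) (snd-injective p) (fst≢snd p)

transpositionsMovingPairs : (p q : Pairs t r) → Σ (Word t) λ w → All Genuine w ×
  (∀ s → prodTransp w (fst p s) ≡ fst q s × prodTransp w (snd p s) ≡ snd q s)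
transpositionsMovingPairs {r = r} p q
  with transpositionsBetween (points p) (points q) (points-injective p) (points-injective q)
... | w , genuine , moves = w , genuine , λ s →
  moved (lookup-++ˡ (fst p) (snd p) s) (moves (s ↑ˡ r)) (lookup-++ˡ (fst q) (snd q) s) ,
  moved (lookup-++ʳ (fst p) (snd p) s) (moves (r ↑ʳ s)) (lookup-++ʳ (fst q) (snd q) s)
  where
  moved : ∀ {x x′ y y′} → x ≡ x′ → prodTransp w x ≡ y → y ≡ y′ → prodTransp w x′ ≡ y′
  moved refl eq refl = eq

-- Two pair systems of the same size r ≥ 1 are related by an EVEN permutation: if the word
-- found above is odd, also swap the two points of the pair s₀ of q.
evenMapping : (p q : Pairs t r) → Fin r → Σ (Permutation′ t) λ π → IsEven π × MapsPairs π p q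
evenMapping p q s₀ with transpositionsMovingPairs p q
... | w , genuine , moves with parity (length w)
...   | inj₁ even = permOf w , permOf-even w (genuine , even) , λ s →
  inj₁ (trans (permOf-action w _) (proj₁ (moves s)) , trans (permOf-action w _) (proj₂ (moves s)))
...   | inj₂ odd = permOf w′ , permOf-even w′ (fst≢snd q s₀ s₀ ∷ genuine , odd) , swapAt₀
  where
  w′ = (fst q s₀ , snd q s₀) ∷ w
  swapAt₀ : MapsPairs (permOf w′) p q
  swapAt₀ s rewrite permOf-action w′ (fst p s) | permOf-action w′ (snd p s) | proj₁ (moves s) | proj₂ (moves s)
    with s ≟ s₀
  ... | yes refl = inj₂ (transpose-left (fst q s) (snd q s) , transpose-right (fst q s) (snd q s))
  ... | no s≢s₀ = inj₁ (transpose-other _ _ _ (s≢s₀ ∘ fst-injective q) (fst≢snd q s s₀) ,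
                        transpose-other _ _ _ (fst≢snd q s₀ s ∘ sym) (s≢s₀ ∘ snd-injective q))

CommutatorConjugate : Permutation′ t → Permutation′ t → Set
CommutatorConjugate {t} α β = Σ (Permutation′ t) λ γ₁ → Σ (Permutation′ t) λ γ₂ →
  IsEven γ₁ × IsEven γ₂ × (∀ z → γ₂ ⟨$⟩ˡ comm α γ₁ (γ₂ ⟨$⟩ʳ z) ≡ β ⟨$⟩ʳ z)

-- If β = S ∘ T for ANY involutions S, T with the pair systems σ, τ of the same size as that
-- of α, then S = π⁻¹απ, T = ρα⁻¹ρ⁻¹ with π, ρ even, and γ₁ = πρ, γ₂ = π work.
commutatorOfInvolutions : (α β : Permutation′ t) (X σ τ : Pairs t r) → Fin r → Swaps (α ⟨$⟩ʳ_) X →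
  (∀ {S T} → Swaps S σ → Swaps T τ → ∀ z → S (T z) ≡ β ⟨$⟩ʳ z) → CommutatorConjugate α β
commutatorOfInvolutions α β X σ τ s₀ α-swaps product with evenMapping σ X s₀ | evenMapping X τ s₀
... | π , π-even , π-maps | ρ , ρ-even , ρ-maps =
  ρ ∘ₚ π , π , even-∘ₚ {π = ρ} {π} ρ-even π-even , π-even , λ z →
  trans (cong (λ w → π ⟨$⟩ˡ (α ⟨$⟩ʳ (π ⟨$⟩ʳ (ρ ⟨$⟩ʳ (α ⟨$⟩ˡ (ρ ⟨$⟩ˡ w)))))) (inverseˡ π))
        (product S-swaps T-swaps z)
  where
  S-swaps = conjugate-swaps (flip π) X σ α-swaps (mapsPairs-flip π σ X π-maps)
  T-swaps = conjugate-swaps ρ X τ (swaps-inverse α X α-swaps) ρ-maps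

Apart : Pairs t m → Pairs t n → Set
Apart p q = ∀ s → fst p s ∉ q × snd p s ∉ q

combine : (p : Pairs t m) (q : Pairs t n) → Apart p q → Pairs t (m + n)
combine p q apart = record
  { fst = fst p ++ fst q
  ; snd = snd p ++ snd q
  ; fst-injective = ++-injective (fst p) (fst q) (fst-injective p) (fst-injective q)
      (λ s s′ → proj₁ (proj₁ (apart s)) s′)
  ; snd-injective = ++-injective (snd p) (snd q) (snd-injective p) (snd-injective q)
      (λ s s′ → proj₂ (proj₂ (apart s)) s′)
  ; fst≢snd = ++-all {P = λ x → ∀ s′ → x ≢ (snd p ++ snd q) s′} (fst p) (fst q)
      (λ s → ++-all {P = fst p s ≢_} (snd p) (snd q) (fst≢snd p s) (proj₂ (proj₁ (apart s))))
      (λ s′ → ++-all {P = fst q s′ ≢_} (snd p) (snd q)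
                (λ s eq → proj₁ (proj₂ (apart s)) s′ (sym eq)) (fst≢snd q s′))
  }

combine-swaps : (p : Pairs t m) (q : Pairs t n) (apart : Apart p q) {F : Fin t → Fin t} →
  SwapsPairs F (combine p q apart) → SwapsPairs F p × SwapsPairs F q
combine-swaps {m = m} {n = n} p q apart {F} sw = left , right
  where
  left : SwapsPairs F p
  left s with sw (s ↑ˡ n)
  ... | e₁ , e₂ rewrite lookup-++ˡ (fst p) (fst q) s | lookup-++ˡ (snd p) (snd q) s = e₁ , e₂
  right : SwapsPairs F q
  right s with sw (m ↑ʳ s)
  ... | e₁ , e₂ rewrite lookup-++ʳ (fst p) (fst q) s | lookup-++ʳ (snd p) (snd q) s = e₁ , e₂

combine-∉ : (p : Pairs t m) (q : Pairs t n) (apart : Apart p q) {z : Fin t} →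
  z ∉ p → z ∉ q → z ∉ combine p q apart
combine-∉ p q apart {z} (z∉fst-p , z∉snd-p) (z∉fst-q , z∉snd-q) =
  ++-all {P = z ≢_} (fst p) (fst q) z∉fst-p z∉fst-q , ++-all {P = z ≢_} (snd p) (snd q) z∉snd-p z∉snd-q

reindex : m ≡ n → Pairs t m → Pairs t n
reindex refl p = p

reindex-swaps : (e : m ≡ n) (p : Pairs t m) {F : Fin t → Fin t} → SwapsPairs F (reindex e p) → SwapsPairs F p
reindex-swaps refl p sw = sw

reindex-∉ : (e : m ≡ n) (p : Pairs t m) {z : Fin t} → z ∉ p → z ∉ reindex e p
reindex-∉ refl p z∉p = z∉p

noPairs : Pairs t 0
noPairs = record { fst = λ () ; snd = λ () ; fst-injective = λ {} ; snd-injective = λ {} ; fst≢snd = λ () }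

pair : (c d : Fin t) → c ≢ d → Pairs t 1
pair c d c≢d = record
  { fst = λ _ → c ; snd = λ _ → d
  ; fst-injective = λ { {zero} {zero} _ → refl } ; snd-injective = λ { {zero} {zero} _ → refl }
  ; fst≢snd = λ _ _ → c≢d }

sharedPairs-cancel : (E : Pairs t m) (p q : Pairs t n) (Ep : Apart E p) (Eq : Apart E q) {F G : Fin t → Fin t} →
  Swaps F (combine E p Ep) → Swaps G (combine E q Eq) → ∀ z → z ∉ p → z ∉ q → F (G z) ≡ z
sharedPairs-cancel E p q Ep Eq {F} {G} F-swaps G-swaps z z∉p z∉q =
  byCases (any? (λ s → z ≟ fst E s)) (any? (λ s → z ≟ snd E s))
  where
  F-on-E = proj₁ (combine-swaps E p Ep {F} (swaps F-swaps))
  G-on-E = proj₁ (combine-swaps E q Eq {G} (swaps G-swaps))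
  byCases : Dec (∃ λ s → z ≡ fst E s) → Dec (∃ λ s → z ≡ snd E s) → F (G z) ≡ z
  byCases (yes (s , refl)) _ = trans (cong F (proj₁ (G-on-E s))) (proj₂ (F-on-E s))
  byCases (no _) (yes (s , refl)) = trans (cong F (proj₂ (G-on-E s))) (proj₁ (F-on-E s))
  byCases (no z∉fst) (no z∉snd) =
    trans (cong F (fixes G-swaps z (combine-∉ E q Eq z∉E z∉q))) (fixes F-swaps z (combine-∉ E p Ep z∉E z∉p))
    where
    z∉E : z ∉ E
    z∉E = (λ s eq → z∉fst (s , eq)) , (λ s eq → z∉snd (s , eq))

InjectiveUpTo : (ℕ → Fin t) → ℕ → Set
InjectiveUpTo f c = ∀ {n n′} → n ≤ c → n′ ≤ c → f n ≡ f n′ → n ≡ n′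

restrict : {f : ℕ → Fin t} {c′ : ℕ} → InjectiveUpTo f c → c′ ≤ c → InjectiveUpTo f c′
restrict f-inj c′≤c n≤c′ n′≤c′ = f-inj (≤-trans n≤c′ c′≤c) (≤-trans n′≤c′ c′≤c)

-- The reflection n ↦ c ∸ n of a path of c + 1 points has m two-cycles: c = 2m - 1 (no fixed
-- point) or c = 2m (the middle point m is fixed).
data Shape (c m : ℕ) : Set where
  odd  : suc c ≡ m + m → Shape c m
  even : c ≡ m + m → Shape c m

shape-bound : Shape c m → m + m ≤ suc c
shape-bound (odd 1+c≡2m) = ≤-reflexive (sym 1+c≡2m)
shape-bound {c} (even c≡2m) = ≤-trans (≤-reflexive (sym c≡2m)) (n≤1+n c)

pair-gap : ∀ {k} → k < m → m + m ≤ suc c → m ≤ c ∸ k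
pair-gap {m} {c} {k} k<m 2m≤1+c = m+n≤o⇒m≤o∸n m (s≤s⁻¹ (begin
  suc (m + k) ≡⟨ +-suc m k ⟨
  m + suc k   ≤⟨ +-monoʳ-≤ m k<m ⟩
  m + m       ≤⟨ 2m≤1+c ⟩
  suc c       ∎))
  where open ≤-Reasoning

index≤ : Shape c m → (k : Fin m) → toℕ k ≤ c
index≤ {c} shape k =
  ≤-trans (<⇒≤ (<-≤-trans (toℕ<n k) (pair-gap (toℕ<n k) (shape-bound shape)))) (m∸n≤m c (toℕ k))

reflection : (f : ℕ → Fin t) → InjectiveUpTo f c → Shape c m → Pairs t m
reflection {c = c} {m} f f-inj shape = record
  { fst = λ k → f (toℕ k)
  ; snd = λ k → f (c ∸ toℕ k)
  ; fst-injective = λ {k} {k′} eq → toℕ-injective (f-inj (index≤ shape k) (index≤ shape k′) eq)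
  ; snd-injective = λ {k} {k′} eq →
      toℕ-injective (∸-cancelˡ-≡ (index≤ shape k) (index≤ shape k′)
        (f-inj (m∸n≤m c (toℕ k)) (m∸n≤m c (toℕ k′)) eq))
  ; fst≢snd = λ k k′ eq →
      <⇒≢ (<-≤-trans (toℕ<n k) (pair-gap (toℕ<n k′) (shape-bound shape)))
          (f-inj (index≤ shape k) (m∸n≤m c (toℕ k′)) eq)
  }

MiddleFixed : (F : Fin t → Fin t) (f : ℕ → Fin t) → Shape c m → Set
MiddleFixed F f (odd _) = ⊤
MiddleFixed {m = m} F f (even _) = F (f m) ≡ f m

-- An involution swapping the pairs of the reflection (and fixing the middle point, if any)
-- acts on the whole path as n ↦ c ∸ n: every index is a k < m, a partner c ∸ k, or the middle.
reflects : (f : ℕ → Fin t) (f-inj : InjectiveUpTo f c) (shape : Shape c m) {F : Fin t → Fin t} →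
  SwapsPairs F (reflection f f-inj shape) → MiddleFixed F f shape → ∀ n → n ≤ c → F (f n) ≡ f (c ∸ n)
reflects {c = c} {m} f f-inj shape {F} sw middle n n≤c = byCases (n <? m) (c ∸ n <? m)
  where
  swapsAt : ∀ {k} → k < m → F (f k) ≡ f (c ∸ k) × F (f (c ∸ k)) ≡ f k
  swapsAt {k} k<m = subst (λ j → F (f j) ≡ f (c ∸ j) × F (f (c ∸ j)) ≡ f j) (toℕ-fromℕ< k<m) (sw (fromℕ< k<m))
  atMiddle : m ≤ n → m ≤ c ∸ n → (shape : Shape c m) → MiddleFixed F f shape → F (f n) ≡ f (c ∸ n)
  atMiddle m≤n m≤c∸n (odd 1+c≡2m) _ =
    ⊥-elim (1+n≰n (subst (_≤ c) (sym 1+c≡2m) (≤-trans (+-monoʳ-≤ m m≤n) (m≤o∸n⇒m+n≤o m n≤c m≤c∸n))))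
  atMiddle m≤n m≤c∸n (even refl) middle
    rewrite ≤-antisym (+-cancelˡ-≤ m n m (m≤o∸n⇒m+n≤o m n≤c m≤c∸n)) m≤n | m+n∸n≡m m m = middle
  byCases : Dec (n < m) → Dec (c ∸ n < m) → F (f n) ≡ f (c ∸ n)
  byCases (yes n<m) _ = proj₁ (swapsAt n<m)
  byCases (no _) (yes k<m) = trans (cong (λ j → F (f j)) (sym (m∸[m∸n]≡n n≤c))) (proj₂ (swapsAt k<m))
  byCases (no n≮m) (no k≮m) = atMiddle (≮⇒≥ n≮m) (≮⇒≥ k≮m) shape middle

offPath-∉ : (f : ℕ → Fin t) (f-inj : InjectiveUpTo f c) (shape : Shape c m) {z : Fin t} →
  (∀ n → n ≤ c → z ≢ f n) → z ∉ reflection f f-inj shape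
offPath-∉ {c = c} f f-inj shape z∉f =
  (λ k → z∉f (toℕ k) (index≤ shape k)) , (λ k → z∉f (c ∸ toℕ k) (m∸n≤m c (toℕ k)))

middle-∉ : (f : ℕ → Fin t) (f-inj : InjectiveUpTo f c) (c≡2m : c ≡ m + m) → f m ∉ reflection f f-inj (even c≡2m)
middle-∉ {c = c} {m} f f-inj c≡2m = notFirst , notSecond
  where
  m≤c : m ≤ c
  m≤c = subst (m ≤_) (sym c≡2m) (m≤m+n m m)
  notFirst : ∀ k → f m ≢ f (toℕ k)
  notFirst k eq = <⇒≢ (toℕ<n k) (sym (f-inj m≤c (index≤ (even c≡2m) k) eq))
  notSecond : ∀ k → f m ≢ f (c ∸ toℕ k)
  notSecond k eq = <⇒≢ (toℕ<n k) (+-cancelˡ-≡ m (toℕ k) m (begin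
    m + toℕ k         ≡⟨ cong (_+ toℕ k) (f-inj m≤c (m∸n≤m c (toℕ k)) eq) ⟩
    c ∸ toℕ k + toℕ k ≡⟨ m∸n+n≡m (index≤ (even c≡2m) k) ⟩
    c                 ≡⟨ c≡2m ⟩
    m + m             ∎))
    where open ≡-Reasoning

reflections-compose : {S T : Fin t → Fin t} (f : ℕ → Fin t) (c : ℕ) →
  (∀ n → n ≤ c → T (f n) ≡ f (c ∸ n)) → (∀ n → n ≤ c → S (f n) ≡ f (suc c ∸ n)) →
  ∀ n → n ≤ c → S (T (f n)) ≡ f (suc n)
reflections-compose {S = S} {T} f c T-reflects S-reflects n n≤c = begin
  S (T (f n))               ≡⟨ cong S (T-reflects n n≤c) ⟩
  S (f (c ∸ n))             ≡⟨ S-reflects (c ∸ n) (m∸n≤m c n) ⟩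
  f (suc c ∸ (c ∸ n))       ≡⟨ cong f (+-∸-assoc 1 (m∸n≤m c n)) ⟩
  f (suc (c ∸ (c ∸ n)))     ≡⟨ cong (f ∘ suc) (m∸[m∸n]≡n n≤c) ⟩
  f (suc n)                 ∎
  where open ≡-Reasoning

around : {X : Set} {k : ℕ} → (Fin (suc k) → X) → ℕ → X
around {k = k} g n = g (n mod suc k)

around-toℕ : {X : Set} {k : ℕ} (g : Fin (suc k) → X) (i : Fin (suc k)) → around g (toℕ i) ≡ g i
around-toℕ g i = cong g (toℕ-injective (trans (toℕ-fromℕ< _) (m<n⇒m%n≡m (toℕ<n i))))

around-period : {X : Set} {k : ℕ} (g : Fin (suc k) → X) → around g (suc k) ≡ around g 0
around-period {k = k} g = cong g (toℕ-injective (trans (toℕ-fromℕ< _) (n%n≡0 (suc k))))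

around-injective : {k : ℕ} (g : Fin (suc k) → Fin t) → Injective _≡_ _≡_ g → InjectiveUpTo (around g) k
around-injective {k = k} g g-inj {n} {n′} n≤k n′≤k eq = begin
  n                       ≡⟨ m<n⇒m%n≡m (s≤s n≤k) ⟨
  n % suc k               ≡⟨ toℕ-fromℕ< _ ⟨
  toℕ (n mod suc k)       ≡⟨ cong toℕ (g-inj eq) ⟩
  toℕ (n′ mod suc k)      ≡⟨ toℕ-fromℕ< _ ⟩
  n′ % suc k              ≡⟨ m<n⇒m%n≡m (s≤s n′≤k) ⟩
  n′                      ∎
  where open ≡-Reasoning

double : (P : ℕ) → P * 2 ≡ P + P
double P = trans (*-comm P 2) (cong (P +_) (+-identityʳ P))

evenShape : (P : ℕ) → Shape (P * 2) P
evenShape P = even (double P)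

oddShape : (P : ℕ) → Shape (suc (P * 2)) (suc P)
oddShape P = odd (cong suc (trans (cong suc (double P)) (sym (+-suc P P))))

-- An injection Fin K → Fin t with K < t misses a point (else choosing preimages would inject
-- Fin t into Fin K).
freshPoint : {K : ℕ} (h : Fin K → Fin t) → Injective _≡_ _≡_ h → K < t → ∃ λ c → ∀ i → h i ≢ c
freshPoint {t} h h-inj K<t with all? (λ z → any? (λ i → h i ≟ z))
... | yes onto = ⊥-elim (<⇒≱ K<t (injective⇒≤ {f = preimage} preimage-injective))
  where
  preimage : Fin t → Fin _
  preimage z = proj₁ (onto z)
  preimage-injective : Injective _≡_ _≡_ preimage
  preimage-injective {z} {z′} eq = trans (sym (proj₂ (onto z))) (trans (cong h eq) (proj₂ (onto z′)))
... | no not-onto with ¬∀⟶∃¬ t _ (λ z → any? (λ i → h i ≟ z)) not-onto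
...   | c , c∉h = c , λ i eq → c∉h (i , eq)

twoFreshPoints : {K : ℕ} (h : Fin K → Fin t) → Injective _≡_ _≡_ h → suc K < t →
  Σ (Fin t) λ c → Σ (Fin t) λ d → c ≢ d × (∀ i → h i ≢ c) × (∀ i → h i ≢ d)
twoFreshPoints {K = K} h h-inj 1+K<t with freshPoint h h-inj (<-trans (n<1+n K) 1+K<t)
... | c , c∉h with freshPoint (c ◂ h) c◂h-injective 1+K<t
  where
  c◂h-injective : Injective _≡_ _≡_ (c ◂ h)
  c◂h-injective {zero} {zero} _ = refl
  c◂h-injective {zero} {suc j} eq = ⊥-elim (c∉h j (sym eq))
  c◂h-injective {suc i} {zero} eq = ⊥-elim (c∉h i eq)
  c◂h-injective {suc i} {suc j} eq = cong suc (h-inj eq)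
...   | d , d∉c◂h = c , d , d∉c◂h zero , c∉h , d∉c◂h ∘ suc

-- The hypothesis t ≡ 2 (mod 4): a multiple K of 4 that fits into t leaves two points free.
roomForTwo : {K : ℕ} → t % 4 ≡ 2 → 4 ∣ K → K ≤ t → suc K < t
roomForTwo {t} t%4≡2 (divides q refl) K≤t = ≤∧≢⇒< (≤∧≢⇒< K≤t K≢t) 1+K≢t
  where
  K≢t : q * 4 ≢ t
  K≢t refl with trans (sym t%4≡2) (m*n%n≡0 q 4)
  ... | ()
  1+K≢t : suc (q * 4) ≢ t
  1+K≢t refl with trans (sym t%4≡2) ([m+kn]%n≡m%n 1 q 4)
  ... | ()

module TwoCycles {t P Q : ℕ} (β : Permutation′ t) (cycles : IsTwoDisjointCycles β (suc P * 2) (suc Q * 2)) where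

  a : Fin (suc P * 2) → Fin t
  a = proj₁ cycles
  b : Fin (suc Q * 2) → Fin t
  b = proj₁ (proj₂ cycles)
  a-injective : Injective _≡_ _≡_ a
  a-injective = proj₁ (proj₂ (proj₂ cycles))
  b-injective : Injective _≡_ _≡_ b
  b-injective = proj₁ (proj₂ (proj₂ (proj₂ cycles)))
  a≢b : ∀ i j → a i ≢ b j
  a≢b = proj₁ (proj₂ (proj₂ (proj₂ (proj₂ cycles))))
  β-on-a : ∀ i → β ⟨$⟩ʳ a i ≡ a (cyc i)
  β-on-a = proj₁ (proj₂ (proj₂ (proj₂ (proj₂ (proj₂ cycles)))))
  β-on-b : ∀ j → β ⟨$⟩ʳ b j ≡ b (cyc j)
  β-on-b = proj₁ (proj₂ (proj₂ (proj₂ (proj₂ (proj₂ (proj₂ cycles))))))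
  β-fixes : ∀ z → (∀ i → z ≢ a i) → (∀ j → z ≢ b j) → β ⟨$⟩ʳ z ≡ z
  β-fixes = proj₂ (proj₂ (proj₂ (proj₂ (proj₂ (proj₂ (proj₂ cycles))))))

  A : ℕ → Fin t
  A = around a
  B : ℕ → Fin t
  B = around b

  A-injective : InjectiveUpTo A (suc (P * 2))
  A-injective = around-injective a a-injective
  A-injective′ : InjectiveUpTo A (P * 2)
  A-injective′ = restrict A-injective (n≤1+n _)
  B-injective : InjectiveUpTo B (suc (Q * 2))
  B-injective = around-injective b b-injective
  B∘suc-injective : InjectiveUpTo (B ∘ suc) (Q * 2)
  B∘suc-injective n≤ n′≤ eq = ℕ-suc-injective (B-injective (s≤s n≤) (s≤s n′≤) eq)

  A≢B : ∀ n n′ → A n ≢ B n′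
  A≢B n n′ = a≢b _ _

  σA : Pairs t (suc P)
  σA = reflection A A-injective (oddShape P)
  σB : Pairs t Q
  σB = reflection (B ∘ suc) B∘suc-injective (evenShape Q)
  τA : Pairs t P
  τA = reflection A A-injective′ (evenShape P)
  τB : Pairs t (suc Q)
  τB = reflection B B-injective (oddShape Q)

  σA-σB-apart : Apart σA σB
  σA-σB-apart s = offPath-∉ (B ∘ suc) B∘suc-injective (evenShape Q) (λ n _ → A≢B (toℕ s) (suc n)) ,
                  offPath-∉ (B ∘ suc) B∘suc-injective (evenShape Q) (λ n _ → A≢B (suc (P * 2) ∸ toℕ s) (suc n))
  τA-τB-apart : Apart τA τB
  τA-τB-apart s = offPath-∉ B B-injective (oddShape Q) (λ n _ → A≢B (toℕ s) n) ,
                  offPath-∉ B B-injective (oddShape Q) (λ n _ → A≢B (P * 2 ∸ toℕ s) n)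

  σ : Pairs t (P + suc Q)
  σ = reindex (sym (+-suc P Q)) (combine σA σB σA-σB-apart)
  τ : Pairs t (P + suc Q)
  τ = combine τA τB τA-τB-apart

  σ-∉ : ∀ {z} → z ∉ σA → z ∉ σB → z ∉ σ
  σ-∉ z∉σA z∉σB = reindex-∉ (sym (+-suc P Q)) _ (combine-∉ σA σB σA-σB-apart z∉σA z∉σB)

  τ-∉ : ∀ {z} → z ∉ τA → z ∉ τB → z ∉ τ
  τ-∉ = combine-∉ τA τB τA-τB-apart

  B₀-∉σ : B 0 ∉ σ
  B₀-∉σ = σ-∉ (offPath-∉ A A-injective (oddShape P) λ n _ eq → A≢B n 0 (sym eq))
              (offPath-∉ (B ∘ suc) B∘suc-injective (evenShape Q)
                 λ n n≤2Q eq → 0≢1+n (B-injective z≤n (s≤s n≤2Q) eq))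

  Bₘ-∉σ : B (suc Q) ∉ σ
  Bₘ-∉σ = σ-∉ (offPath-∉ A A-injective (oddShape P) λ n _ eq → A≢B n (suc Q) (sym eq))
              (middle-∉ (B ∘ suc) B∘suc-injective (double Q))

  Aₘ-∉τ : A P ∉ τ
  Aₘ-∉τ = τ-∉ (middle-∉ A A-injective′ (double P)) (offPath-∉ B B-injective (oddShape Q) λ n _ → A≢B P n)

  Aₑ-∉τ : A (suc (P * 2)) ∉ τ
  Aₑ-∉τ = τ-∉ (offPath-∉ A A-injective′ (evenShape P) beyondPath)
              (offPath-∉ B B-injective (oddShape Q) λ n _ → A≢B (suc (P * 2)) n)
    where
    beyondPath : ∀ n → n ≤ P * 2 → A (suc (P * 2)) ≢ A n
    beyondPath n n≤2P eq = 1+n≰n (subst (_≤ P * 2) (sym (A-injective ≤-refl (≤-trans n≤2P (n≤1+n _)) eq)) n≤2P)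

  OffCycles : Fin t → Set
  OffCycles z = (∀ i → z ≢ a i) × (∀ j → z ≢ b j)

  offCycles-∉σ : ∀ {z} → OffCycles z → z ∉ σ
  offCycles-∉σ (z∉a , z∉b) = σ-∉ (offPath-∉ A A-injective (oddShape P) (λ n _ → z∉a _))
                                 (offPath-∉ (B ∘ suc) B∘suc-injective (evenShape Q) (λ n _ → z∉b _))

  offCycles-∉τ : ∀ {z} → OffCycles z → z ∉ τ
  offCycles-∉τ (z∉a , z∉b) = τ-∉ (offPath-∉ A A-injective′ (evenShape P) (λ n _ → z∉a _))
                                 (offPath-∉ B B-injective (oddShape Q) (λ n _ → z∉b _))

  record ReflectionPair (S T : Fin t → Fin t) : Set where
    field
      S-σA       : SwapsPairs S σA
      S-σB       : SwapsPairs S σB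
      S-fixes-B₀ : S (B 0) ≡ B 0
      S-fixes-Bₘ : S (B (suc Q)) ≡ B (suc Q)
      T-τA       : SwapsPairs T τA
      T-τB       : SwapsPairs T τB
      T-fixes-Aₘ : T (A P) ≡ A P
      T-fixes-Aₑ : T (A (suc (P * 2))) ≡ A (suc (P * 2))
      cancel-off : ∀ z → OffCycles z → S (T z) ≡ z

  -- On a: T reflects about 2P (fixing a_{2P+1}), S about 2P + 1.  On b: T reflects about
  -- 2Q + 1 and S about 2Q + 2 ≡ 0.  Hence S ∘ T rotates both cycles, as β does.
  rotates : {S T : Fin t → Fin t} → ReflectionPair S T → ∀ z → S (T z) ≡ β ⟨$⟩ʳ z
  rotates {S} {T} R z = byCases (any? (λ i → a i ≟ z)) (any? (λ j → b j ≟ z))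
    where
    open ReflectionPair R
    open ≡-Reasoning
    T-reflects-A : ∀ n → n ≤ P * 2 → T (A n) ≡ A (P * 2 ∸ n)
    T-reflects-A = reflects A A-injective′ (evenShape P) {T} T-τA T-fixes-Aₘ
    S-reflects-A : ∀ n → n ≤ suc (P * 2) → S (A n) ≡ A (suc (P * 2) ∸ n)
    S-reflects-A = reflects A A-injective (oddShape P) {S} S-σA tt
    T-reflects-B : ∀ n → n ≤ suc (Q * 2) → T (B n) ≡ B (suc (Q * 2) ∸ n)
    T-reflects-B = reflects B B-injective (oddShape Q) {T} T-τB tt
    S-reflects-B : ∀ n → n ≤ suc (Q * 2) → S (B n) ≡ B (suc (suc (Q * 2)) ∸ n)
    S-reflects-B zero _ = trans S-fixes-B₀ (sym (around-period b))
    S-reflects-B (suc n) n<2Q+1 = trans (reflects (B ∘ suc) B∘suc-injective (evenShape Q) {S} S-σB S-fixes-Bₘ n n≤2Q)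
                                       (cong B (sym (+-∸-assoc 1 n≤2Q)))
      where
      n≤2Q : n ≤ Q * 2
      n≤2Q = s≤s⁻¹ n<2Q+1
    A-rotates : ∀ n → n ≤ suc (P * 2) → S (T (A n)) ≡ A (suc n)
    A-rotates n n≤ with n ≤? P * 2
    ... | yes n≤2P = reflections-compose {S = S} {T} A (P * 2) T-reflects-A
                       (λ m m≤2P → S-reflects-A m (≤-trans m≤2P (n≤1+n _))) n n≤2P
    ... | no n≰2P rewrite ≤-antisym n≤ (≰⇒> n≰2P) = begin
      S (T (A (suc (P * 2))))          ≡⟨ cong S T-fixes-Aₑ ⟩
      S (A (suc (P * 2)))              ≡⟨ S-reflects-A (suc (P * 2)) ≤-refl ⟩
      A (suc (P * 2) ∸ suc (P * 2))    ≡⟨ cong A (n∸n≡0 (suc (P * 2))) ⟩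
      A 0                              ≡⟨ around-period a ⟨
      A (suc (suc (P * 2)))            ∎
    B-rotates : ∀ n → n ≤ suc (Q * 2) → S (T (B n)) ≡ B (suc n)
    B-rotates = reflections-compose {S = S} {T} B (suc (Q * 2)) T-reflects-B S-reflects-B
    byCases : Dec (∃ λ i → a i ≡ z) → Dec (∃ λ j → b j ≡ z) → S (T z) ≡ β ⟨$⟩ʳ z
    byCases (yes (i , refl)) _ = begin
      S (T (a i))              ≡⟨ cong (S ∘ T) (around-toℕ a i) ⟨
      S (T (A (toℕ i)))        ≡⟨ A-rotates (toℕ i) (s≤s⁻¹ (toℕ<n i)) ⟩
      a (cyc i)                ≡⟨ β-on-a i ⟨
      β ⟨$⟩ʳ a i               ∎
    byCases (no _) (yes (j , refl)) = begin
      S (T (b j))              ≡⟨ cong (S ∘ T) (around-toℕ b j) ⟨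
      S (T (B (toℕ j)))        ≡⟨ B-rotates (toℕ j) (s≤s⁻¹ (toℕ<n j)) ⟩
      b (cyc j)                ≡⟨ β-on-b j ⟨
      β ⟨$⟩ʳ b j               ∎
    byCases (no z∉a) (no z∉b) = trans (cancel-off z off) (sym (β-fixes z (proj₁ off) (proj₂ off)))
      where
      off : OffCycles z
      off = (λ i eq → z∉a (i , sym eq)) , (λ j eq → z∉b (j , sym eq))

  OffCyclePairs : {e : ℕ} → Pairs t e → Set
  OffCyclePairs E = ∀ s → OffCycles (fst E s) × OffCycles (snd E s)

  module WithExtraPairs {e : ℕ} (E : Pairs t e) (E-off : OffCyclePairs E) where

    E-σ-apart : Apart E σ
    E-σ-apart s = offCycles-∉σ (proj₁ (E-off s)) , offCycles-∉σ (proj₂ (E-off s))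

    E-τ-apart : Apart E τ
    E-τ-apart s = offCycles-∉τ (proj₁ (E-off s)) , offCycles-∉τ (proj₂ (E-off s))

    A-∉E : ∀ n → A n ∉ E
    A-∉E n = (λ s eq → proj₁ (proj₁ (E-off s)) _ (sym eq)) , (λ s eq → proj₁ (proj₂ (E-off s)) _ (sym eq))

    B-∉E : ∀ n → B n ∉ E
    B-∉E n = (λ s eq → proj₂ (proj₁ (E-off s)) _ (sym eq)) , (λ s eq → proj₂ (proj₂ (E-off s)) _ (sym eq))

    reflectionPair : {S T : Fin t → Fin t} →
      Swaps S (combine E σ E-σ-apart) → Swaps T (combine E τ E-τ-apart) → ReflectionPair S T
    reflectionPair {S} {T} S-swaps T-swaps = record
      { S-σA = proj₁ S-on-σ
      ; S-σB = proj₂ S-on-σ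
      ; S-fixes-B₀ = S-fixes (B 0) (B-∉E 0) B₀-∉σ
      ; S-fixes-Bₘ = S-fixes (B (suc Q)) (B-∉E (suc Q)) Bₘ-∉σ
      ; T-τA = proj₁ T-on-τ
      ; T-τB = proj₂ T-on-τ
      ; T-fixes-Aₘ = T-fixes (A P) (A-∉E P) Aₘ-∉τ
      ; T-fixes-Aₑ = T-fixes (A (suc (P * 2))) (A-∉E (suc (P * 2))) Aₑ-∉τ
      ; cancel-off = λ z off →
          sharedPairs-cancel E σ τ E-σ-apart E-τ-apart S-swaps T-swaps z (offCycles-∉σ off) (offCycles-∉τ off)
      }
      where
      S-on-σ : SwapsPairs S σA × SwapsPairs S σB
      S-on-σ = combine-swaps σA σB σA-σB-apart {S}
        (reindex-swaps (sym (+-suc P Q)) _ {S} (proj₂ (combine-swaps E σ E-σ-apart {S} (swaps S-swaps))))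
      T-on-τ : SwapsPairs T τA × SwapsPairs T τB
      T-on-τ = combine-swaps τA τB τA-τB-apart {T} (proj₂ (combine-swaps E τ E-τ-apart {T} (swaps T-swaps)))
      S-fixes : ∀ z → z ∉ E → z ∉ σ → S z ≡ z
      S-fixes z z∉E z∉σ = fixes S-swaps z (combine-∉ E σ E-σ-apart z∉E z∉σ)
      T-fixes : ∀ z → z ∉ E → z ∉ τ → T z ≡ z
      T-fixes z z∉E z∉τ = fixes T-swaps z (combine-∉ E τ E-τ-apart z∉E z∉τ)

    commutatorWithExtraPairs : (α : Permutation′ t) → IsDisjointTranspositions α (e + (P + suc Q)) →
      CommutatorConjugate α β
    commutatorWithExtraPairs α α-transpositions with transpositionPairs α α-transpositions
    ... | X , α-swaps = commutatorOfInvolutions α β X (combine E σ E-σ-apart) (combine E τ E-τ-apart)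
          (e ↑ʳ (P ↑ʳ zero)) α-swaps (λ S-swaps T-swaps → rotates (reflectionPair S-swaps T-swaps))

  sparePair : t % 4 ≡ 2 → 2 ∣ suc P + suc Q → Σ (Pairs t 1) OffCyclePairs
  sparePair t%4≡2 (divides w r≡w*2)
    with twoFreshPoints (a ++ b) (++-injective a b a-injective b-injective a≢b)
           (roomForTwo t%4≡2 (divides w k≡w*4) (injective⇒≤ (++-injective a b a-injective b-injective a≢b)))
    where
    k≡w*4 : suc P * 2 + suc Q * 2 ≡ w * 4
    k≡w*4 = trans (sym (*-distribʳ-+ 2 (suc P) (suc Q))) (trans (cong (_* 2) r≡w*2) (*-assoc w 2 2))
  ... | c , d , c≢d , c-fresh , d-fresh = pair c d c≢d , λ _ → off c-fresh , off d-fresh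
    where
    off : ∀ {x} → (∀ k → (a ++ b) k ≢ x) → OffCycles x
    off x-fresh = (λ i eq → x-fresh (i ↑ˡ _) (trans (lookup-++ˡ a b i) (sym eq))) ,
                  (λ j eq → x-fresh (suc P * 2 ↑ʳ j) (trans (lookup-++ʳ a b j) (sym eq)))

  commutator : ∀ {r} → t % 4 ≡ 2 → r ≡ P + suc Q ⊎ r ≡ suc P + suc Q → 2 ∣ r →
    (α : Permutation′ t) → IsDisjointTranspositions α r → CommutatorConjugate α β
  commutator _ (inj₁ refl) _ = WithExtraPairs.commutatorWithExtraPairs noPairs (λ ())
  commutator t%4≡2 (inj₂ refl) 2∣r with sparePair t%4≡2 2∣r
  ... | E , E-off = WithExtraPairs.commutatorWithExtraPairs E E-off

evenLength : {k : ℕ} → 2 ≤ k → 2 ∣ k → ∃ λ P → k ≡ suc P * 2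
evenLength 2≤k (divides (suc P) k≡) = P , k≡
evenLength 2≤k (divides zero k≡0) with subst (2 ≤_) k≡0 2≤k
... | ()

halfOfSum : (m n : ℕ) → (m * 2 + n * 2) / 2 ≡ m + n
halfOfSum m n = trans (cong (_/ 2) (sym (*-distribʳ-+ 2 m n))) (m*n/n≡m (m + n) 2)

transpositionCount : (P Q : ℕ) {r : ℕ} → r ≡ (suc P * 2 + suc Q * 2) / 2 ⊎ r ≡ (suc P * 2 + suc Q * 2) / 2 ∸ 1 →
  r ≡ P + suc Q ⊎ r ≡ suc P + suc Q
transpositionCount P Q (inj₁ r≡k/2) = inj₂ (trans r≡k/2 (halfOfSum (suc P) (suc Q)))
transpositionCount P Q (inj₂ r≡k/2-1) = inj₁ (trans r≡k/2-1 (cong (_∸ 1) (halfOfSum (suc P) (suc Q))))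

lemma2p6 : (t : ℕ) → t % 4 ≡ 2 →
    (k₁ k₂ : ℕ) → 2 ≤ k₁ → 2 ≤ k₂ → 2 ∣ k₁ → 2 ∣ k₂ →
    (β : Permutation′ t) → IsEven β → IsTwoDisjointCycles β k₁ k₂ →
    (r : ℕ) → (r ≡ (k₁ + k₂) / 2 ⊎ r ≡ (k₁ + k₂) / 2 ∸ 1) → 2 ∣ r →
    (α : Permutation′ t) → IsEven α → IsDisjointTranspositions α r →
    Σ (Permutation′ t) λ γ₁ → Σ (Permutation′ t) λ γ₂ →
      IsEven γ₁ × IsEven γ₂ ×
      (∀ z → γ₂ ⟨$⟩ˡ comm α γ₁ (γ₂ ⟨$⟩ʳ z) ≡ β ⟨$⟩ʳ z)
lemma2p6 t t%4≡2 k₁ k₂ 2≤k₁ 2≤k₂ 2∣k₁ 2∣k₂ β _ cycles r r≡ 2∣r α _ α-transpositions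
  with evenLength 2≤k₁ 2∣k₁ | evenLength 2≤k₂ 2∣k₂
... | P , refl | Q , refl =
  TwoCycles.commutator β cycles t%4≡2 (transpositionCount P Q r≡) 2∣r α α-transpositions
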